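{- If $T$ is a tree on $n$ vertices, then $\pi^{c}(T)\le \lceil 2n/3\rceil$.
   Context: A configuration of cops on $T$ is a function $C:V(T)\to\mathbb{Z}_{\ge 0}$ of size $\sum_v C(v)$. A pebbling step from a vertex $u$ with at least two cops to an adjacent vertex $v$ removes two cops from $u$ and adds one cop to $v$. In the cops and robbers pebbling game, cops are placed according to $C$, then a robber chooses a starting vertex; thereafter, in each turn the cops make pebbling steps, after which the robber either moves to an adjacent vertex or stays put. The robber is captured when he occupies a vertex holding at least one cop. The cop pebbling number $\pi^{c}(T)$ is the minimum $m$ such that some configuration of size $m$ allows the cops to capture the robber regardless of how he starts and moves. -}

module Defs where

open import Data.Nat using (ℕ; zero; suc; _+_; _*_; _∸_; _≤_; _/_)
open import Data.Bool using (Bool; true; false; T; if_then_else_)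
open import Data.Fin using (Fin; _≟_)
open import Data.List using (List; []; _∷_; _++_; [_]; length; map; allFin)
open import Data.Nat.ListAction using (sum)
open import Data.List.Relation.Unary.Linked using (Linked)
open import Data.List.Relation.Unary.Unique.Propositional using (Unique)
open import Data.Product using (Σ; ∃; _×_; _,_)
open import Data.Sum using (_⊎_)
open import Relation.Nullary using (¬_)
open import Relation.Nullary.Decidable using (⌊_⌋)
open import Relation.Binary.PropositionalEquality using (_≡_)
open import Relation.Binary.Construct.Closure.ReflexiveTransitive using (Star)

record Graph (n : ℕ) : Set where
  field
    adj    : Fin n → Fin n → Bool
    sym    : ∀ u v → adj u v ≡ adj v u
    irrefl : ∀ u → adj u u ≡ false

module _ {n : ℕ} (G : Graph n) where
  open Graph G

  Adj : Fin n → Fin n → Set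
  Adj u v = T (adj u v)

  data Walk : Fin n → Fin n → Set where
    here : ∀ {u} → Walk u u
    _∷_  : ∀ {u v w} → Adj u v → Walk v w → Walk u w

  Connected : Set
  Connected = ∀ u v → Walk u v

  IsCycle : Fin n → List (Fin n) → Set
  IsCycle x xs = (2 ≤ length xs) × Unique (x ∷ xs) × Linked Adj (x ∷ xs ++ [ x ])

  Acyclic : Set
  Acyclic = ∀ x xs → ¬ IsCycle x xs

  IsTree : Set
  IsTree = Connected × Acyclic

Config : ℕ → Set
Config n = Fin n → ℕ

size : ∀ {n} → Config n → ℕ
size {n} C = sum (map C (allFin n))

pebble : ∀ {n} → Config n → Fin n → Fin n → Config n
pebble C u v w =
  if ⌊ w ≟ u ⌋ then C w ∸ 2 else (if ⌊ w ≟ v ⌋ then suc (C w) else C w)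

module _ {n : ℕ} (G : Graph n) where

  data PebblingStep (C : Config n) : Config n → Set where
    step : ∀ u v → Adj G u v → 2 ≤ C u → PebblingStep C (pebble C u v)

  CopTurn : Config n → Config n → Set
  CopTurn = Star PebblingStep

  RobberMove : Fin n → Fin n → Set
  RobberMove r r' = r ≡ r' ⊎ Adj G r r'

  Captured : Config n → Fin n → Set
  Captured C r = 1 ≤ C r

  -- CopsWin C r : with cops at C and the robber at r (cops to move),
  -- the cops can force a capture in finitely many turns against every
  -- robber strategy.
  data CopsWin (C : Config n) (r : Fin n) : Set where
    caught : Captured C r → CopsWin C r
    turn   : ∀ C' → CopTurn C C' →
             (Captured C' r ⊎ (∀ r' → RobberMove r r' → CopsWin C' r')) →
             CopsWin C r

  Winning : Config n → Set
  Winning C = ∀ r → CopsWin C r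

  CopPebblingNumber≤ : ℕ → Set
  CopPebblingNumber≤ m = Σ (Config n) λ C → size C ≤ m × Winning C

ceil2n/3 : ℕ → ℕ
ceil2n/3 n = (2 * n + 2) / 3

module Submission where

-- The cops win in their first turn as soon as, wherever the robber stands, they can pebble
-- a cop onto his vertex.  Such a covering configuration of size ⌈2n/3⌉ exists in every
-- connected graph: take a spanning tree and build it bottom-up.
-- For a subtree with N nodes we keep a configuration `main` covering it on its own, with
-- 3|main| ≤ 2N + surplus, and a configuration `topped` covering it once one more cop sits
-- on its root, with 3|topped| + slack ≤ 2N.  The shape used at a node is dictated by the
-- total slack of its children; in each case the node itself, worth 2 in the budget, pays
-- for the cops placed on it.  At the root surplus ≤ 2, so 3|main| ≤ 2n + 2.

open import Defs
open import Data.Bool using (T)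
open import Data.Empty using (⊥-elim)
open import Data.Fin using (Fin; _≟_) renaming (zero to fzero; suc to fsuc)
open import Data.Fin.Properties using (all?; ¬∀⟶∃¬)
open import Data.List using (List; []; _∷_)
open import Data.List.Properties using (map-tabulate)
open import Data.Nat using (ℕ; zero; suc; _+_; _*_; _∸_; _≤_; _/_; z≤n; s≤s; _≤?_; NonZero)
open import Data.Nat.DivMod using (m*n/n≡m; /-monoˡ-≤)
open import Data.Nat.ListAction using (sum)
open import Data.Nat.Properties hiding (_≟_)
open import Data.Nat.Tactic.RingSolver using (solve-∀)
open import Data.Product using (∃; ∃-syntax; ∃₂; _×_; _,_)
open import Data.Sum using (inj₁)
open import Data.Unit using (⊤)
open import Function using (_∘_; _$_; id)
open import Level using (0ℓ)
open import Relation.Nullary using (¬_; yes; no)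
open import Relation.Unary using (Pred; Decidable)
open import Relation.Binary.PropositionalEquality
open import Relation.Binary.Construct.Closure.ReflexiveTransitive using (ε; _◅_; _◅◅_)

private
  variable
    n : ℕ

infixl 6 _⊕_
infix 4 _≤ᶜ_

_⊕_ : Config n → Config n → Config n
(C ⊕ D) w = C w + D w

0ᶜ : Config n
0ᶜ _ = 0

_≤ᶜ_ : Config n → Config n → Set
C ≤ᶜ D = ∀ w → C w ≤ D w

≤ᶜ-⊕ˡ : (C D : Config n) → C ≤ᶜ C ⊕ D
≤ᶜ-⊕ˡ C D w = m≤m+n (C w) (D w)

≤ᶜ-⊕ʳ : (C D : Config n) → D ≤ᶜ C ⊕ D
≤ᶜ-⊕ʳ C D w = m≤n+m (D w) (C w)

δ : Fin n → ℕ → Config n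
δ fzero    k fzero    = k
δ fzero    k (fsuc w) = 0
δ (fsuc p) k fzero    = 0
δ (fsuc p) k (fsuc w) = δ p k w

δ-self : (p : Fin n) (k : ℕ) → δ p k p ≡ k
δ-self fzero    k = refl
δ-self (fsuc p) k = δ-self p k

δ-≢ : (p w : Fin n) (k : ℕ) → w ≢ p → δ p k w ≡ 0
δ-≢ fzero    fzero    k w≢p = ⊥-elim (w≢p refl)
δ-≢ fzero    (fsuc w) k w≢p = refl
δ-≢ (fsuc p) fzero    k w≢p = refl
δ-≢ (fsuc p) (fsuc w) k w≢p = δ-≢ p w k (w≢p ∘ cong fsuc)

δ-support : (p w : Fin n) (k : ℕ) → 1 ≤ δ p k w → w ≡ p
δ-support p w k 1≤δ with w ≟ p
... | yes w≡p = w≡p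
... | no  w≢p = ⊥-elim (<⇒≱ 1≤δ (≤-reflexive (δ-≢ p w k w≢p)))

δ-≤ : (p w : Fin n) (k : ℕ) → δ p k w ≤ k
δ-≤ fzero    fzero    k = ≤-refl
δ-≤ fzero    (fsuc w) k = z≤n
δ-≤ (fsuc p) fzero    k = z≤n
δ-≤ (fsuc p) (fsuc w) k = δ-≤ p w k

δ-mono : (p : Fin n) {j k : ℕ} → j ≤ k → δ p j ≤ᶜ δ p k
δ-mono fzero    j≤k fzero    = j≤k
δ-mono fzero    j≤k (fsuc w) = z≤n
δ-mono (fsuc p) j≤k fzero    = z≤n
δ-mono (fsuc p) j≤k (fsuc w) = δ-mono p j≤k w

δ-+ : (p : Fin n) (j k : ℕ) → δ p (j + k) ≗ δ p j ⊕ δ p k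
δ-+ fzero    j k fzero    = refl
δ-+ fzero    j k (fsuc w) = refl
δ-+ (fsuc p) j k fzero    = refl
δ-+ (fsuc p) j k (fsuc w) = δ-+ p j k w

size-suc : (C : Config (suc n)) → size C ≡ C fzero + size (C ∘ fsuc)
size-suc {n} C = cong (λ cs → C fzero + sum cs)
  (trans (map-tabulate fsuc C) (sym (map-tabulate id (C ∘ fsuc))))

size-cong : {C D : Config n} → C ≗ D → size C ≡ size D
size-cong {zero}  C≗D = refl
size-cong {suc n} {C} {D} C≗D = begin
  size C                        ≡⟨ size-suc C ⟩
  C fzero + size (C ∘ fsuc)     ≡⟨ cong₂ _+_ (C≗D fzero) (size-cong (C≗D ∘ fsuc)) ⟩
  D fzero + size (D ∘ fsuc)     ≡⟨ size-suc D ⟨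
  size D                        ∎
  where open ≡-Reasoning

size-mono : {C D : Config n} → C ≤ᶜ D → size C ≤ size D
size-mono {zero}  C≤D = z≤n
size-mono {suc n} {C} {D} C≤D = begin
  size C                        ≡⟨ size-suc C ⟩
  C fzero + size (C ∘ fsuc)     ≤⟨ +-mono-≤ (C≤D fzero) (size-mono (C≤D ∘ fsuc)) ⟩
  D fzero + size (D ∘ fsuc)     ≡⟨ size-suc D ⟨
  size D                        ∎
  where open ≤-Reasoning

size-⊕ : (C D : Config n) → size (C ⊕ D) ≡ size C + size D
size-⊕ {zero}  C D = refl
size-⊕ {suc n} C D = begin
  size (C ⊕ D)
    ≡⟨ size-suc (C ⊕ D) ⟩
  (C fzero + D fzero) + size ((C ∘ fsuc) ⊕ (D ∘ fsuc))
    ≡⟨ cong (C fzero + D fzero +_) (size-⊕ (C ∘ fsuc) (D ∘ fsuc)) ⟩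
  (C fzero + D fzero) + (size (C ∘ fsuc) + size (D ∘ fsuc))
    ≡⟨ +-+-comm (C fzero) (D fzero) _ _ ⟩
  (C fzero + size (C ∘ fsuc)) + (D fzero + size (D ∘ fsuc))
    ≡⟨ cong₂ _+_ (size-suc C) (size-suc D) ⟨
  size C + size D
    ∎
  where
  open ≡-Reasoning
  +-+-comm : ∀ a b c d → (a + b) + (c + d) ≡ (a + c) + (b + d)
  +-+-comm = solve-∀

size-const : (k : ℕ) → size {n} (λ _ → k) ≡ n * k
size-const {zero}  k = refl
size-const {suc n} k = trans (size-suc {n} (λ _ → k)) (cong (k +_) (size-const {n} k))

size-0ᶜ : size {n} 0ᶜ ≡ 0
size-0ᶜ {n} = trans (size-const {n} 0) (*-zeroʳ n)

size-δ : (p : Fin n) (k : ℕ) → size (δ p k) ≡ k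
size-δ {suc n} fzero k = trans (size-suc {n} (δ fzero k)) (trans (cong (k +_) (size-0ᶜ {n})) (+-identityʳ k))
size-δ {suc n} (fsuc p) k = trans (size-suc (δ (fsuc p) k)) (size-δ p k)

size-δ-⊕ : (p : Fin n) (k : ℕ) (C : Config n) → size (δ p k ⊕ C) ≡ k + size C
size-δ-⊕ p k C = trans (size-⊕ (δ p k) C) (cong (_+ size C) (size-δ p k))

size-≤1 : {C : Config n} → C ≤ᶜ (λ _ → 1) → size C ≤ n
size-≤1 {n} C≤1 = ≤-trans (size-mono C≤1) (≤-reflexive (trans (size-const {n} 1) (*-identityʳ n)))

record Budget (C : Config n) (a : ℕ) (D : Config n) (b : ℕ) : Set where
  constructor budget
  field bound : 3 * size C + a ≤ 2 * size D + b

budget-weaken : {C D : Config n} {a a′ b b′ : ℕ} →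
                a′ ≤ a → b ≤ b′ → Budget C a D b → Budget C a′ D b′
budget-weaken a′≤a b≤b′ (budget h) = budget (≤-trans (+-monoʳ-≤ _ a′≤a) (≤-trans h (+-monoʳ-≤ _ b≤b′)))

budget-⊕ : {C C′ D D′ : Config n} {a a′ b b′ : ℕ} →
           Budget C a D b → Budget C′ a′ D′ b′ → Budget (C ⊕ C′) (a + a′) (D ⊕ D′) (b + b′)
budget-⊕ {C = C} {C′} {D} {D′} {a} {a′} {b} {b′} (budget h) (budget h′) = budget (begin
  3 * size (C ⊕ C′) + (a + a′)          ≡⟨ cong (λ s → 3 * s + (a + a′)) (size-⊕ C C′) ⟩
  3 * (size C + size C′) + (a + a′)     ≡⟨ regroup 3 (size C) (size C′) a a′ ⟩
  (3 * size C + a) + (3 * size C′ + a′) ≤⟨ +-mono-≤ h h′ ⟩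
  (2 * size D + b) + (2 * size D′ + b′) ≡⟨ regroup 2 (size D) (size D′) b b′ ⟨
  2 * (size D + size D′) + (b + b′)     ≡⟨ cong (λ s → 2 * s + (b + b′)) (size-⊕ D D′) ⟨
  2 * size (D ⊕ D′) + (b + b′)          ∎)
  where
  open ≤-Reasoning
  regroup : ∀ k x y a a′ → k * (x + y) + (a + a′) ≡ (k * x + a) + (k * y + a′)
  regroup = solve-∀

-- The new node p is worth 2 in the budget; the side condition says that this pays for
-- the k cops added to C and for the change of corrections.
budget-node : {C C′ D : Config n} {a a′ b b′ k : ℕ} (p : Fin n) →
              Budget C a D b → 3 * k + a′ + b ≤ 2 + a + b′ → size C′ ≡ k + size C →
              Budget C′ a′ (δ p 1 ⊕ D) b′
budget-node {C = C} {C′} {D} {a} {a′} {b} {b′} {k} p (budget h) cond size≡ =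
  budget $ +-cancelʳ-≤ (a + b) _ _ (begin
    3 * size C′ + a′ + (a + b)            ≡⟨ cong (λ s → 3 * s + a′ + (a + b)) size≡ ⟩
    3 * (k + size C) + a′ + (a + b)       ≡⟨ lhs k (size C) a a′ b ⟩
    (3 * k + a′ + b) + (3 * size C + a)   ≤⟨ +-mono-≤ cond h ⟩
    (2 + a + b′) + (2 * size D + b)       ≡⟨ rhs (size D) a b b′ ⟩
    2 * (1 + size D) + b′ + (a + b)       ≡⟨ cong (λ s → 2 * s + b′ + (a + b)) (size-δ-⊕ p 1 D) ⟨
    2 * size (δ p 1 ⊕ D) + b′ + (a + b)   ∎)
  where
  open ≤-Reasoning
  lhs : ∀ k s a a′ b → 3 * (k + s) + a′ + (a + b) ≡ (3 * k + a′ + b) + (3 * s + a)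
  lhs = solve-∀
  rhs : ∀ d a b b′ → (2 + a + b′) + (2 * d + b) ≡ 2 * (1 + d) + b′ + (a + b)
  rhs = solve-∀

n*m≤o⇒m≤o/n : ∀ n m o .{{_ : NonZero n}} → n * m ≤ o → m ≤ o / n
n*m≤o⇒m≤o/n n m o nm≤o = begin
  m           ≡⟨ m*n/n≡m m n ⟨
  m * n / n   ≤⟨ /-monoˡ-≤ n (≤-trans (≤-reflexive (*-comm m n)) nm≤o) ⟩
  o / n       ∎
  where open ≤-Reasoning

data Tree (n : ℕ) : Set where
  node : Fin n → List (Tree n) → Tree n

root : Tree n → Fin n
root (node p _) = p

mutual
  occ : Tree n → Config n
  occ (node p ts) = δ p 1 ⊕ occs ts

  occs : List (Tree n) → Config n
  occs []       = 0ᶜ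
  occs (t ∷ ts) = occ t ⊕ occs ts

root-occurs : (t : Tree n) → 1 ≤ occ t (root t)
root-occurs (node p ts) = ≤-trans (≤-reflexive (sym (δ-self p 1))) (m≤m+n _ _)

hang : Fin n → Fin n → Fin n → List (Tree n) → List (Tree n)
hang u w p ts with p ≟ u
... | yes _ = node w [] ∷ ts
... | no  _ = ts

mutual
  graft : Fin n → Fin n → Tree n → Tree n
  graft u w (node p ts) = node p (hang u w p (grafts u w ts))

  grafts : Fin n → Fin n → List (Tree n) → List (Tree n)
  grafts u w []       = []
  grafts u w (t ∷ ts) = graft u w t ∷ grafts u w ts

mutual
  occ-graft : (u w : Fin n) (t : Tree n) (x : Fin n) →
              occ (graft u w t) x ≡ occ t x + occ t u * δ w 1 x
  occ-graft u w (node p ts) x with p ≟ u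
  ... | yes refl rewrite occs-grafts u w ts x | δ-self p 1 =
    shift (δ p 1 x) (occs ts x) (occs ts p) (δ w 1 x)
    where
    shift : ∀ a b c d → a + ((d + 0) + (b + c * d)) ≡ a + b + (1 + c) * d
    shift = solve-∀
  ... | no p≢u rewrite occs-grafts u w ts x | δ-≢ p u 1 (p≢u ∘ sym) =
    sym (+-assoc (δ p 1 x) (occs ts x) _)

  occs-grafts : (u w : Fin n) (ts : List (Tree n)) (x : Fin n) →
                occs (grafts u w ts) x ≡ occs ts x + occs ts u * δ w 1 x
  occs-grafts u w []       x = refl
  occs-grafts u w (t ∷ ts) x rewrite occ-graft u w t x | occs-grafts u w ts x =
    shift (occ t x) (occ t u) (occs ts x) (occs ts u) (δ w 1 x)
    where
    shift : ∀ a b c e d → a + b * d + (c + e * d) ≡ a + c + (b + e) * d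
    shift = solve-∀

-- How `main` (below) covers the root of a subtree: by one cop on it, by two cops on it,
-- or by a cop pebbled up from a child.
data Kind : Set where
  single double borrowed : Kind

slack : Kind → ℕ
slack single   = 2
slack double   = 1
slack borrowed = 0

surplus : Kind → ℕ
surplus single   = 1
surplus double   = 2
surplus borrowed = 0

surplus≤2*slack : (κ : Kind) → surplus κ ≤ 2 * slack κ
surplus≤2*slack single   = s≤s z≤n
surplus≤2*slack double   = ≤-refl
surplus≤2*slack borrowed = z≤n

surplus≤2 : (κ : Kind) → surplus κ ≤ 2
surplus≤2 single   = s≤s z≤n
surplus≤2 double   = ≤-refl
surplus≤2 borrowed = z≤n

module _ {n : ℕ} (G : Graph n) where

  Adj-sym : {u v : Fin n} → Adj G u v → Adj G v u
  Adj-sym {u} {v} = subst T (Graph.sym G u v)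

  Adj-irrefl : {u v : Fin n} → Adj G u v → u ≢ v
  Adj-irrefl {u} uv refl = subst T (Graph.irrefl G u) uv

  infix 4 _⇝_
  record _⇝_ (C P : Config n) : Set where
    constructor reach
    field
      after  : Config n
      moves  : CopTurn G C after
      enough : P ≤ᶜ after

  pebble-frame : {C D X : Config n} (u v : Fin n) → 2 ≤ C u → D ≗ C ⊕ X →
                 pebble D u v ≗ pebble C u v ⊕ X
  pebble-frame {X = X} u v 2≤Cu D≗ w with w ≟ u
  ... | yes refl rewrite D≗ w = +-∸-comm (X w) 2≤Cu
  ... | no _ with w ≟ v
  ... | yes _ = cong suc (D≗ w)
  ... | no  _ = D≗ w

  turn-frame : {C C′ D : Config n} (X : Config n) → CopTurn G C C′ → D ≗ C ⊕ X →
               ∃[ D′ ] CopTurn G D D′ × D′ ≗ C′ ⊕ X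
  turn-frame X ε D≗ = _ , ε , D≗
  turn-frame {C} {D = D} X (step u v uv 2≤Cu ◅ moves) D≗
    with turn-frame X moves (pebble-frame u v 2≤Cu D≗)
  ... | D′ , moves′ , D′≗ = D′ , step u v uv 2≤Du ◅ moves′ , D′≗
    where
    2≤Du : 2 ≤ D u
    2≤Du = ≤-trans 2≤Cu (≤-trans (m≤m+n (C u) (X u)) (≤-reflexive (sym (D≗ u))))

  ≤ᶜ⇒⇝ : {C P : Config n} → P ≤ᶜ C → C ⇝ P
  ≤ᶜ⇒⇝ P≤C = reach _ ε P≤C

  ⇝-frame : {C P : Config n} (X : Config n) → C ⇝ P → C ⊕ X ⇝ P ⊕ X
  ⇝-frame X (reach C′ moves P≤C′) with turn-frame X moves (λ _ → refl)
  ... | D′ , moves′ , D′≗ =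
    reach D′ moves′ λ w → ≤-trans (+-monoˡ-≤ (X w) (P≤C′ w)) (≤-reflexive (sym (D′≗ w)))

  ⇝-monoˡ : {C D P : Config n} → C ≤ᶜ D → C ⇝ P → D ⇝ P
  ⇝-monoˡ {C} {D} C≤D (reach C′ moves P≤C′)
    with turn-frame (λ w → D w ∸ C w) moves (λ w → sym (m+[n∸m]≡n (C≤D w)))
  ... | D′ , moves′ , D′≗ =
    reach D′ moves′ λ w → ≤-trans (P≤C′ w) (≤-trans (m≤m+n _ _) (≤-reflexive (sym (D′≗ w))))

  ⇝-trans : {C P Q : Config n} → C ⇝ P → P ⇝ Q → C ⇝ Q
  ⇝-trans (reach C′ moves P≤C′) P⇝Q with ⇝-monoˡ P≤C′ P⇝Q
  ... | reach C″ moves′ Q≤C″ = reach C″ (moves ◅◅ moves′) Q≤C″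

  ⇝-step : {u v : Fin n} → Adj G u v → δ u 2 ⇝ δ v 1
  ⇝-step {u} {v} uv = reach (pebble (δ u 2) u v) (step u v uv (≤-reflexive (sym (δ-self u 2))) ◅ ε) lands
    where
    lands : δ v 1 ≤ᶜ pebble (δ u 2) u v
    lands w with w ≟ u
    ... | yes refl = ≤-trans (≤-reflexive (δ-≢ v w 1 (Adj-irrefl uv))) z≤n
    ... | no _ with w ≟ v
    ... | yes refl = ≤-trans (δ-≤ w w 1) (s≤s z≤n)
    ... | no  w≢v  = ≤-trans (≤-reflexive (δ-≢ v w 1 w≢v)) z≤n

  record Covers (C D : Config n) : Set where
    constructor covering
    field cover : ∀ v → 1 ≤ D v → C ⇝ δ v 1
  open Covers

  covers-⊕ : {C D E : Config n} → Covers C D → Covers C E → Covers C (D ⊕ E)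
  covers-⊕ {C} {D} {E} C-D C-E = covering cover-⊕
    where
    cover-⊕ : ∀ v → 1 ≤ D v + E v → C ⇝ δ v 1
    cover-⊕ v 1≤ with D v in Dv
    ... | zero  = cover C-E v 1≤
    ... | suc _ = cover C-D v (≤-trans (s≤s z≤n) (≤-reflexive (sym Dv)))

  covers-δ : {C : Config n} (p : Fin n) (k : ℕ) → C ⇝ δ p 1 → Covers C (δ p k)
  covers-δ {C} p k C⇝p = covering λ v 1≤ → subst (λ w → C ⇝ δ w 1) (sym (δ-support p v k 1≤)) C⇝p

  covers-⇝ : {C C′ D : Config n} → C ⇝ C′ → Covers C′ D → Covers C D
  covers-⇝ C⇝C′ C′-D = covering λ v 1≤ → ⇝-trans C⇝C′ (cover C′-D v 1≤)

  covers-mono : {C C′ D : Config n} → C ≤ᶜ C′ → Covers C D → Covers C′ D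
  covers-mono C≤C′ = covers-⇝ (≤ᶜ⇒⇝ C≤C′)

  covering-wins : {C : Config n} → (∀ r → C ⇝ δ r 1) → Winning G C
  covering-wins reaches r with reaches r
  ... | reach C′ moves r≤C′ = turn C′ moves (inj₁ (≤-trans (≤-reflexive (sym (δ-self r 1))) (r≤C′ r)))

  mutual
    Embedded : Tree n → Set
    Embedded (node p ts) = EmbeddedUnder p ts

    EmbeddedUnder : Fin n → List (Tree n) → Set
    EmbeddedUnder p []       = ⊤
    EmbeddedUnder p (t ∷ ts) = Adj G p (root t) × Embedded t × EmbeddedUnder p ts

  mutual
    graft-embedded : {u w : Fin n} → Adj G u w → (t : Tree n) → Embedded t → Embedded (graft u w t)
    graft-embedded {u} uw (node p ts) emb with p ≟ u
    ... | yes refl = uw , _ , grafts-embedded uw ts emb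
    ... | no  _    = grafts-embedded uw ts emb

    grafts-embedded : {u w p : Fin n} → Adj G u w → (ts : List (Tree n)) →
                      EmbeddedUnder p ts → EmbeddedUnder p (grafts u w ts)
    grafts-embedded uw []               _                  = _
    grafts-embedded uw (node q ss ∷ ts) (pq , emb , embs) =
      pq , graft-embedded uw (node q ss) emb , grafts-embedded uw ts embs

  crossing : {P : Pred (Fin n) 0ℓ} → Decidable P → {x y : Fin n} → Walk G x y → P x → ¬ P y →
             ∃₂ λ u w → Adj G u w × P u × ¬ P w
  crossing P? here                 Px ¬Py = ⊥-elim (¬Py Px)
  crossing P? (_∷_ {v = v} xv walk) Px ¬Py with P? v
  ... | yes Pv = crossing P? walk Pv ¬Py
  ... | no ¬Pv = _ , v , xv , Px , ¬Pv

  Spanning : Tree n → Set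
  Spanning t = Embedded t × occ t ≗ (λ _ → 1)

  extend : Connected G → (t : Tree n) → Embedded t → occ t ≤ᶜ (λ _ → 1) → ¬ (∀ v → 1 ≤ occ t v) →
           ∃[ t′ ] Embedded t′ × occ t′ ≤ᶜ (λ _ → 1) × size (occ t′) ≡ suc (size (occ t))
  extend connected t emb ≤1 ¬all
    with ¬∀⟶∃¬ n _ (λ v → 1 ≤? occ t v) ¬all
  ... | x , x∉t
    with crossing (λ v → 1 ≤? occ t v) (connected (root t) x) (root-occurs t) x∉t
  ... | u , w , uw , u∈t , w∉t =
    graft u w t , graft-embedded uw t emb , ≤1′ , size′
    where
    w-absent : occ t w ≡ 0
    w-absent = n<1⇒n≡0 (≰⇒> w∉t)
    occ′ : occ (graft u w t) ≗ occ t ⊕ δ w 1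
    occ′ x = begin
      occ (graft u w t) x          ≡⟨ occ-graft u w t x ⟩
      occ t x + occ t u * δ w 1 x  ≡⟨ cong (λ c → occ t x + c * δ w 1 x) (≤-antisym (≤1 u) u∈t) ⟩
      occ t x + 1 * δ w 1 x        ≡⟨ cong (occ t x +_) (*-identityˡ (δ w 1 x)) ⟩
      occ t x + δ w 1 x            ∎
      where open ≡-Reasoning
    ≤1′ : occ (graft u w t) ≤ᶜ (λ _ → 1)
    ≤1′ x with x ≟ w
    ... | yes refl = ≤-reflexive (trans (occ′ x) (cong₂ _+_ w-absent (δ-self x 1)))
    ... | no  x≢w  = begin
      occ (graft u w t) x  ≡⟨ occ′ x ⟩
      occ t x + δ w 1 x    ≡⟨ cong (occ t x +_) (δ-≢ w x 1 x≢w) ⟩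
      occ t x + 0          ≡⟨ +-identityʳ _ ⟩
      occ t x              ≤⟨ ≤1 x ⟩
      1                    ∎
      where open ≤-Reasoning
    size′ : size (occ (graft u w t)) ≡ suc (size (occ t))
    size′ = begin
      size (occ (graft u w t))     ≡⟨ size-cong occ′ ⟩
      size (occ t ⊕ δ w 1)         ≡⟨ size-⊕ (occ t) (δ w 1) ⟩
      size (occ t) + size (δ w 1)  ≡⟨ cong (size (occ t) +_) (size-δ w 1) ⟩
      size (occ t) + 1             ≡⟨ +-comm _ 1 ⟩
      suc (size (occ t))           ∎
      where open ≡-Reasoning

  grow : Connected G → (k : ℕ) (t : Tree n) → Embedded t → occ t ≤ᶜ (λ _ → 1) →
         k + size (occ t) ≡ suc n → ∃ Spanning
  grow connected k t emb ≤1 count with all? (λ v → 1 ≤? occ t v)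
  ... | yes all = t , emb , λ v → ≤-antisym (≤1 v) (all v)
  ... | no ¬all with k
  ...   | zero  = ⊥-elim (<⇒≱ (≤-reflexive (sym count)) (size-≤1 ≤1))
  ...   | suc k with extend connected t emb ≤1 ¬all
  ...     | t′ , emb′ , ≤1′ , size′ =
    grow connected k t′ emb′ ≤1′ (trans (cong (k +_) size′) (trans (+-suc k _) count))

  spanningTree : Connected G → Fin n → ∃ Spanning
  spanningTree connected r = grow connected n (node r []) _ ≤1 count
    where
    ≤1 : occ (node r []) ≤ᶜ (λ _ → 1)
    ≤1 w = ≤-trans (≤-reflexive (+-identityʳ _)) (δ-≤ r w 1)
    count : n + size (occ (node r [])) ≡ suc n
    count = trans (cong (n +_) (trans (size-δ-⊕ r 1 0ᶜ) (cong suc (size-0ᶜ {n})))) (+-comm n 1)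

  record Strategy (t : Tree n) (κ : Kind) : Set where
    field
      topped        : Config n
      topped-covers : Covers (δ (root t) 1 ⊕ topped) (occ t)
      topped-budget : Budget topped (slack κ) (occ t) 0
      main          : Config n
      main-covers   : Covers main (occ t)
      main-budget   : Budget main 0 (occ t) (surplus κ)
      main-doubles  : κ ≡ double → main ⇝ δ (root t) 2

  record ForestStrategy (p : Fin n) (ts : List (Tree n)) (s : ℕ) : Set where
    field
      topped        : Config n
      topped-covers : Covers (δ p 2 ⊕ topped) (occs ts)
      topped-budget : Budget topped s (occs ts) 0
      main          : Config n
      main-covers   : Covers main (occs ts)
      main-budget   : Budget main 0 (occs ts) (2 * s)
      main-feeds    : s ≡ 1 → main ⇝ δ p 1

  emptyForest : (p : Fin n) → ForestStrategy p [] 0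
  emptyForest p = record
    { topped = 0ᶜ ; topped-covers = covering λ _ () ; topped-budget = nothing-costs
    ; main   = 0ᶜ ; main-covers   = covering λ _ () ; main-budget   = nothing-costs
    ; main-feeds = λ () }
    where
    nothing-costs : Budget 0ᶜ 0 0ᶜ 0
    nothing-costs = budget $ subst (λ s → 3 * s + 0 ≤ 2 * s + 0) (sym (size-0ᶜ {n})) z≤n

  feed-parent : {p r : Fin n} {M M′ : Config n} {s : ℕ} (κ : Kind) → Adj G r p →
                (κ ≡ double → M ⇝ δ r 2) → (s ≡ 1 → M′ ⇝ δ p 1) → slack κ + s ≡ 1 → M ⊕ M′ ⇝ δ p 1
  feed-parent single   rp doubles feeds ()
  feed-parent double   rp doubles feeds _   = ⇝-monoˡ (≤ᶜ-⊕ˡ _ _) (⇝-trans (doubles refl) (⇝-step rp))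
  feed-parent borrowed rp doubles feeds s≡1 = ⇝-monoˡ (≤ᶜ-⊕ʳ _ _) (feeds s≡1)

  consForest : {p : Fin n} {t : Tree n} {ts : List (Tree n)} {s : ℕ} (κ : Kind) → Adj G p (root t) →
               Strategy t κ → ForestStrategy p ts s → ForestStrategy p (t ∷ ts) (slack κ + s)
  consForest {p} {t} {ts} {s} κ pt S F = record
    { topped        = S.topped ⊕ F.topped
    ; topped-covers = covers-⊕ (covers-⇝ pass-down S.topped-covers)
                               (covers-mono (λ w → +-monoʳ-≤ (δ p 2 w) (≤ᶜ-⊕ʳ S.topped F.topped w))
                                            F.topped-covers)
    ; topped-budget = budget-⊕ S.topped-budget F.topped-budget
    ; main          = S.main ⊕ F.main
    ; main-covers   = covers-⊕ (covers-mono (≤ᶜ-⊕ˡ _ _) S.main-covers)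
                               (covers-mono (≤ᶜ-⊕ʳ _ _) F.main-covers)
    ; main-budget   = budget-weaken ≤-refl (≤-reflexive (sym (*-distribˡ-+ 2 (slack κ) s)))
                        (budget-⊕ (budget-weaken ≤-refl (surplus≤2*slack κ) S.main-budget) F.main-budget)
    ; main-feeds    = feed-parent κ (Adj-sym pt) S.main-doubles F.main-feeds
    }
    where
    module S = Strategy S
    module F = ForestStrategy F
    pass-down : δ p 2 ⊕ (S.topped ⊕ F.topped) ⇝ δ (root t) 1 ⊕ S.topped
    pass-down = ⇝-monoˡ (λ w → +-monoʳ-≤ (δ p 2 w) (≤ᶜ-⊕ˡ S.topped F.topped w))
                        (⇝-frame S.topped (⇝-step pt))

  nodeStrategy : {p : Fin n} {ts : List (Tree n)} (s : ℕ) → ForestStrategy p ts s → ∃ (Strategy (node p ts))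
  nodeStrategy {p} {ts} 0 F = single , record
    { topped        = F.main
    ; topped-covers = covers-own
    ; topped-budget = budget-node p F.main-budget ≤-refl refl
    ; main          = δ p 1 ⊕ F.main
    ; main-covers   = covers-own
    ; main-budget   = budget-node p F.main-budget ≤-refl (size-δ-⊕ p 1 F.main)
    ; main-doubles  = λ ()
    }
    where
    module F = ForestStrategy F
    covers-own : Covers (δ p 1 ⊕ F.main) (δ p 1 ⊕ occs ts)
    covers-own = covers-⊕ (covers-δ p 1 (≤ᶜ⇒⇝ (≤ᶜ-⊕ˡ (δ p 1) F.main)))
                          (covers-mono (≤ᶜ-⊕ʳ _ _) F.main-covers)
  nodeStrategy {p} {ts} 1 F = borrowed , record
    { topped        = F.main
    ; topped-covers = covers-mono (≤ᶜ-⊕ʳ _ _) covers-all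
    ; topped-budget = budget-all
    ; main          = F.main
    ; main-covers   = covers-all
    ; main-budget   = budget-all
    ; main-doubles  = λ ()
    }
    where
    module F = ForestStrategy F
    covers-all : Covers F.main (δ p 1 ⊕ occs ts)
    covers-all = covers-⊕ (covers-δ p 1 (F.main-feeds refl)) F.main-covers
    budget-all : Budget F.main 0 (δ p 1 ⊕ occs ts) 0
    budget-all = budget-node p F.main-budget ≤-refl refl
  nodeStrategy {p} {ts} (suc (suc k)) F = double , record
    { topped        = δ p 1 ⊕ F.topped
    ; topped-covers = covers-mono merge covers-own
    ; topped-budget = budget-node p budget₂ ≤-refl (size-δ-⊕ p 1 F.topped)
    ; main          = δ p 2 ⊕ F.topped
    ; main-covers   = covers-own
    ; main-budget   = budget-node p budget₂ ≤-refl (size-δ-⊕ p 2 F.topped)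
    ; main-doubles  = λ _ → ≤ᶜ⇒⇝ (≤ᶜ-⊕ˡ _ _)
    }
    where
    module F = ForestStrategy F
    budget₂ : Budget F.topped 2 (occs ts) 0
    budget₂ = budget-weaken (s≤s (s≤s z≤n)) ≤-refl F.topped-budget
    merge : δ p 2 ⊕ F.topped ≤ᶜ δ p 1 ⊕ (δ p 1 ⊕ F.topped)
    merge w = ≤-reflexive (trans (cong (_+ F.topped w) (δ-+ p 1 1 w)) (+-assoc (δ p 1 w) (δ p 1 w) (F.topped w)))
    covers-own : Covers (δ p 2 ⊕ F.topped) (δ p 1 ⊕ occs ts)
    covers-own = covers-⊕ (covers-δ p 1 (≤ᶜ⇒⇝ λ w → ≤-trans (δ-mono p {1} {2} (s≤s z≤n) w)
                                                           (≤ᶜ-⊕ˡ (δ p 2) F.topped w)))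
                          F.topped-covers

  mutual
    strategy : (t : Tree n) → Embedded t → ∃ (Strategy t)
    strategy (node p ts) emb with forestStrategy p ts emb
    ... | s , F = nodeStrategy s F

    forestStrategy : (p : Fin n) (ts : List (Tree n)) → EmbeddedUnder p ts → ∃ (ForestStrategy p ts)
    forestStrategy p []       _                  = 0 , emptyForest p
    forestStrategy p (t ∷ ts) (pt , emb , embs) with strategy t emb | forestStrategy p ts embs
    ... | κ , S | s , F = slack κ + s , consForest κ pt S F

  connected⇒copPebblingNumber≤ : Connected G → Fin n → CopPebblingNumber≤ G (ceil2n/3 n)
  connected⇒copPebblingNumber≤ connected r with spanningTree connected r
  ... | t , emb , occ≗1 with strategy t emb
  ... | κ , S = S.main , n*m≤o⇒m≤o/n 3 _ _ cost , covering-wins reaches-all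
    where
    module S = Strategy S
    reaches-all : ∀ v → S.main ⇝ δ v 1
    reaches-all v = cover S.main-covers v (≤-reflexive (sym (occ≗1 v)))
    size-t : size (occ t) ≡ n
    size-t = trans (size-cong occ≗1) (trans (size-const {n} 1) (*-identityʳ n))
    cost : 3 * size S.main ≤ 2 * n + 2
    cost = begin
      3 * size S.main                ≡⟨ +-identityʳ _ ⟨
      3 * size S.main + 0            ≤⟨ Budget.bound S.main-budget ⟩
      2 * size (occ t) + surplus κ   ≤⟨ +-mono-≤ (≤-reflexive (cong (2 *_) size-t)) (surplus≤2 κ) ⟩
      2 * n + 2                      ∎
      where open ≤-Reasoning

theorem9 : (n : ℕ) (T : Graph n) → IsTree T → CopPebblingNumber≤ T (ceil2n/3 n)
theorem9 zero    T _               = (λ ()) , z≤n , λ ()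
theorem9 (suc n) T (connected , _) = connected⇒copPebblingNumber≤ T connected fzero
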